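{- Let $U$ be a countably infinite set and $\mathrm{G}$ a subgroup of $\mathfrak{S}(U)$. The set of copies $\overline{\mathrm{G}}[U]$ has no isolated point (for the powerset topology, relative to $\overline{\mathrm{G}}[U]$) if and only if $\overline{\mathrm{G}}[U]\neq\{U\}$.
   Context: $\overline{\mathrm{G}}$ is the closure of $\mathrm{G}$ in $U^U$ for the function topology: the set of maps $f:U\to U$ such that for every finite $E\subseteq U$ some $g\in\mathrm{G}$ agrees with $f$ on $E$. $\overline{\mathrm{G}}[U]=\{f[U]\mid f\in\overline{\mathrm{G}}\}$. The powerset topology on $\mathcal{P}(U)$ has basic open sets $\{A\subseteq U\mid F\subseteq A,\ E\cap A=\emptyset\}$ for $F,E$ finite subsets of $U$. -}

module Defs where

open import Data.Nat using (ℕ)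
open import Data.List using (List)
open import Data.List.Relation.Unary.All using (All)
open import Data.Product using (Σ; ∃; ∃-syntax; _×_; _,_)
open import Data.Unit using (⊤)
open import Relation.Nullary using (¬_)
open import Relation.Binary.PropositionalEquality using (_≡_)
open import Function using (_∘_; id)

record Perm (U : Set) : Set where
  field
    to      : U → U
    from    : U → U
    to-from : ∀ x → to (from x) ≡ x
    from-to : ∀ x → from (to x) ≡ x
open Perm public

idPerm : {U : Set} → Perm U
idPerm = record { to = id ; from = id ; to-from = λ _ → Relation.Binary.PropositionalEquality.refl
                ; from-to = λ _ → Relation.Binary.PropositionalEquality.refl }

Subset : Set → Set₁
Subset U = U → Set

SameSet : {U : Set} → Subset U → Subset U → Set
SameSet {U} A B = ∀ (x : U) → (A x → B x) × (B x → A x)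

record IsSubgroup {U : Set} (G : Perm U → Set) : Set where
  field
    has-id   : ∃[ e ] (G e × ∀ x → to e x ≡ x)
    has-comp : ∀ g h → G g → G h → ∃[ k ] (G k × ∀ x → to k x ≡ to g (to h x))
    has-inv  : ∀ g → G g → ∃[ k ] (G k × ∀ x → to k x ≡ from g x)

-- f ∈ closure of G in U^U: every finite E ⊆ U (given as a list) has some g ∈ G
-- agreeing with f on E.
InClosure : {U : Set} → (Perm U → Set) → (U → U) → Set
InClosure {U} G f = ∀ (E : List U) → ∃[ g ] (G g × All (λ x → f x ≡ to g x) E)

Image : {U : Set} → (U → U) → Subset U
Image {U} f y = ∃[ x ] (f x ≡ y)

-- Basic open set of the powerset topology determined by finite F, E:
-- {A | F ⊆ A, E ∩ A = ∅}.
InBasic : {U : Set} → List U → List U → Subset U → Set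
InBasic F E A = All A F × All (λ x → ¬ A x) E

Isolated : {U : Set} → (Perm U → Set) → (U → U) → Set
Isolated {U} G f =
  ∃[ F ] ∃[ E ] (InBasic F E (Image f) ×
    (∀ (g : U → U) → InClosure G g → InBasic F E (Image g) → SameSet (Image g) (Image f)))

NoIsolatedPoint : {U : Set} → (Perm U → Set) → Set
NoIsolatedPoint {U} G = ∀ (f : U → U) → InClosure G f → ¬ Isolated G f

CopiesEqFull : {U : Set} → (Perm U → Set) → Set
CopiesEqFull {U} G =
  (∀ (f : U → U) → InClosure G f → SameSet (Image f) (λ _ → ⊤)) ×
  (∃[ f ] (InClosure G f × SameSet (Image f) (λ _ → ⊤)))

module Submission where

open import Defs
open import Data.Nat using (ℕ)
open import Function.Bundles using (_↔_; _⇔_; mk⇔)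
open import Relation.Nullary using (¬_)
open import Data.List using (List; []; _∷_; map)
open import Data.List.Relation.Unary.All as All using (All; []; _∷_)
open import Data.List.Relation.Unary.All.Properties using (map⁻)
open import Data.Product using (∃-syntax; _×_; _,_; proj₂)
open import Data.Unit using (tt)
open import Relation.Binary.PropositionalEquality
open import Function using (_∘_; id)

-- If a copy f[U] is isolated, witnessed by a basic open set (F, E), then for any copy
-- g[U] choose k ∈ G undoing g on the f-preimages of F.  The copy (f ∘ k ∘ g)[U] lies
-- inside f[U], hence avoids E, and contains F, so isolation forces it to equal f[U].
-- As f and k are injective, g[U] = U.  Thus an isolated copy exists only when every
-- copy is U.

to-injective : {U : Set} (k : Perm U) {x y : U} → to k x ≡ to k y → x ≡ y
to-injective k {x} {y} eq = begin
  x                ≡⟨ sym (from-to k x) ⟩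
  from k (to k x)  ≡⟨ cong (from k) eq ⟩
  from k (to k y)  ≡⟨ from-to k y ⟩
  y                ∎
  where open ≡-Reasoning

Image-∘-⊆ : {U : Set} (f h : U → U) {y : U} → Image (f ∘ h) y → Image f y
Image-∘-⊆ f h (x , eq) = h x , eq

preimages : {U : Set} {f : U → U} {F : List U} → All (Image f) F → List U
preimages []             = []
preimages ((x , _) ∷ ps) = x ∷ preimages ps

Image-∘-fixing-preimages : {U : Set} (f h : U → U) {F : List U} (ps : All (Image f) F) →
  All (λ x → h x ≡ x) (preimages ps) → All (Image (f ∘ h)) F
Image-∘-fixing-preimages f h []              []            = []
Image-∘-fixing-preimages f h ((x , eq) ∷ ps) (fix ∷ fixes) =
  (x , trans (cong f fix) eq) ∷ Image-∘-fixing-preimages f h ps fixes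

copies-full⇒isolated : {U : Set} {G : Perm U → Set} →
  (∀ g → InClosure G g → ∀ x → Image g x) → ∀ {f} → InClosure G f → Isolated G f
copies-full⇒isolated full {f} f∈ =
  [] , [] , ([] , []) , λ g g∈ _ x → (λ _ → full f f∈ x) , (λ _ → full g g∈ x)

module Closure {U : Set} {G : Perm U → Set} (subgroup : IsSubgroup G) where
  open IsSubgroup subgroup

  id∈closure : InClosure G id
  id∈closure E with has-id
  ... | e , e∈G , e-id = e , e∈G , All.universal (λ x → sym (e-id x)) E

  G⊆closure : ∀ {k} → G k → InClosure G (to k)
  G⊆closure {k} k∈G E = k , k∈G , All.universal (λ _ → refl) E

  closure-∘ : ∀ {f g} → InClosure G f → InClosure G g → InClosure G (f ∘ g)
  closure-∘ {f} {g} f∈ g∈ E with g∈ E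
  ... | g₁ , g₁∈G , g≈g₁ with f∈ (map g E)
  ... | f₁ , f₁∈G , f≈f₁ with has-comp f₁ g₁ f₁∈G g₁∈G
  ... | k , k∈G , k≡f₁g₁ = k , k∈G , All.zipWith agree (map⁻ f≈f₁ , g≈g₁)
    where
    agree : ∀ {x} → (f (g x) ≡ to f₁ (g x)) × (g x ≡ to g₁ x) → f (g x) ≡ to k x
    agree {x} (eqf , eqg) = trans eqf (trans (cong (to f₁) eqg) (sym (k≡f₁g₁ x)))

  closure-injective : ∀ {f} → InClosure G f → ∀ {x y} → f x ≡ f y → x ≡ y
  closure-injective {f} f∈ {x} {y} eq with f∈ (x ∷ y ∷ [])
  ... | g , _ , fx≡gx ∷ fy≡gy ∷ [] = to-injective g (trans (sym fx≡gx) (trans eq fy≡gy))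

  closure-locally-invertible : ∀ {g} → InClosure G g → (E : List U) →
    ∃[ k ] (G k × All (λ x → to k (g x) ≡ x) E)
  closure-locally-invertible {g} g∈ E with g∈ E
  ... | g₁ , g₁∈G , g≈g₁ with has-inv g₁ g₁∈G
  ... | k , k∈G , k≡g₁⁻¹ = k , k∈G , All.map undo g≈g₁
    where
    undo : ∀ {x} → g x ≡ to g₁ x → to k (g x) ≡ x
    undo {x} eq = trans (k≡g₁⁻¹ (g x)) (trans (cong (from g₁) eq) (from-to g₁ x))

  isolated⇒copies-full : ∀ {f} → InClosure G f → Isolated G f →
    ∀ {g} → InClosure G g → ∀ y → Image g y
  isolated⇒copies-full {f} f∈ (F , E , (F⊆f[U] , E∩f[U]≡∅) , isolated) {g} g∈ y
    with closure-locally-invertible g∈ (preimages F⊆f[U])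
  ... | k , k∈G , undoes with proj₂ (same-copy (f (to k y))) (to k y , refl)
    where
    h : U → U
    h = f ∘ to k ∘ g

    same-copy : SameSet (Image h) (Image f)
    same-copy = isolated h (closure-∘ f∈ (closure-∘ (G⊆closure k∈G) g∈))
      ( Image-∘-fixing-preimages f (to k ∘ g) F⊆f[U] undoes
      , All.map (λ y∉f[U] → y∉f[U] ∘ Image-∘-⊆ f (to k ∘ g)) E∩f[U]≡∅ )
  ... | x , hx≡fky = x , to-injective k (closure-injective f∈ hx≡fky)

corollary3p11 : {U : Set} → U ↔ ℕ → (G : Perm U → Set) → IsSubgroup G →
    NoIsolatedPoint G ⇔ (¬ CopiesEqFull G)
corollary3p11 _ G subgroup = mk⇔ no-isolated⇒not-full not-full⇒no-isolated
  where
  open Closure subgroup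

  no-isolated⇒not-full : NoIsolatedPoint G → ¬ CopiesEqFull G
  no-isolated⇒not-full no-isolated (all-full , f , f∈ , _) =
    no-isolated f f∈ (copies-full⇒isolated (λ g g∈ x → proj₂ (all-full g g∈ x) tt) f∈)

  not-full⇒no-isolated : ¬ CopiesEqFull G → NoIsolatedPoint G
  not-full⇒no-isolated not-full f f∈ isolated =
    not-full ( (λ g g∈ x → (λ _ → tt) , (λ _ → isolated⇒copies-full f∈ isolated g∈ x))
             , id , id∈closure , (λ x → (λ _ → tt) , (λ _ → x , refl)) )
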